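{- Let $\mathcal{C}$ be a frieze with coefficients on an $n$-gon over the positive integers. Assume that $\gcd(a,b)=\gcd(b,c)=\gcd(a,c)$ for every triangle in $\mathcal{C}$ with side labels $a,b,c$, and that $\mathcal{C}$ contains a $(p+1)$-subpolygon $\mathcal{D}$, for some prime number $p$, such that the labels of all edges and diagonals of $\mathcal{D}$ have the same $p$-valuation $m$. Then the label of every edge and diagonal of $\mathcal{C}$ is divisible by $p^m$.
   Context: Label the vertices of a regular $n$-gon by $0,\dots,n-1$ in cyclic order. A frieze with coefficients on the $n$-gon over a set $R$ is a map assigning to each edge or diagonal $\{i,j\}$ a value $c_{i,j}=c_{j,i}\in R$ such that $c_{i,k}c_{j,\ell}=c_{i,\ell}c_{j,k}+c_{i,j}c_{k,\ell}$ for all vertices $i<j<k<\ell$. A $k$-subpolygon is the restriction to edges and diagonals among a set of $k$ vertices (with inherited cyclic order); a triangle is a 3-subpolygon, with side labels its three values. The $p$-valuation of a positive integer is the exponent of $p$ in it. -}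

module Defs where

open import Data.Nat using (ℕ; suc; _+_; _*_; _^_; _<_; _≤_)
open import Data.Nat.Divisibility using (_∣_)
open import Data.Nat.GCD using (gcd)
open import Data.Fin using (Fin) renaming (_<_ to _<ᶠ_)
open import Data.Product using (_×_)
open import Relation.Nullary using (¬_)
open import Relation.Binary.PropositionalEquality using (_≡_; _≢_)
open import Function.Definitions using (Injective)

-- Vertices are Fin n (cyclic order = order of Fin n).  The label of the
-- edge/diagonal {i,j} (i ≠ j) is c i j; the values c i i are irrelevant.
record IsPositiveFrieze (n : ℕ) (c : Fin n → Fin n → ℕ) : Set where
  field
    symmetric : ∀ i j → i ≢ j → c i j ≡ c j i
    positive  : ∀ i j → i ≢ j → 1 ≤ c i j
    ptolemy   : ∀ i j k l → i <ᶠ j → j <ᶠ k → k <ᶠ l →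
                c i k * c j l ≡ c i l * c j k + c i j * c k l

TrianglesGcdCondition : (n : ℕ) → (Fin n → Fin n → ℕ) → Set
TrianglesGcdCondition n c =
  ∀ i j k → i <ᶠ j → j <ᶠ k →
    (gcd (c i j) (c j k) ≡ gcd (c j k) (c i k)) ×
    (gcd (c j k) (c i k) ≡ gcd (c i j) (c i k))

HasValuation : ℕ → ℕ → ℕ → Set
HasValuation p m x = (p ^ m ∣ x) × ¬ (p ^ suc m ∣ x)

SubpolygonWithValuation : (n : ℕ) → (Fin n → Fin n → ℕ) → (k p m : ℕ) → (Fin k → Fin n) → Set
SubpolygonWithValuation n c k p m v =
  Injective _≡_ _≡_ v × (∀ a b → a ≢ b → HasValuation p m (c (v a) (v b)))

module Submission where

-- Proof of Proposition 4.2.  Let D = {v 0, …, v p} be the given (p+1)-subpolygon.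
--
-- (1) Triangles.  By the gcd condition a common divisor of two sides of a triangle
--     divides the third side.
-- (2) Edges towards D.  Let x ∉ D and suppose p^m ∤ c(x, v k₀).  Then c(x, v k₀) has
--     valuation t < m, and by (1) every edge x–v k has valuation exactly t.  Write
--     c(x, v k) = U k · p^t and c(v a, v b) = W a b · p^m with p ∤ U, W.  Let v a₀ be
--     the first vertex of D after x in cyclic order.  Ptolemy's relation for the
--     cyclically ordered x, v a₀, v b, v e reads  U b · W a₀ e = U e · W a₀ b + U a₀ · W b e,
--     so the p residues U b · (W a₀ b)⁻¹ mod p (b ≠ a₀) are nonzero and pairwise distinct:
--     impossible by the pigeonhole principle.
-- (3) Any edge i–j: if an endpoint lies in D use (2), otherwise apply (1) to i, v 0, j.

open import Defs
open import Data.Nat using (ℕ; zero; suc; _+_; _*_; _^_; _<_; _≤_; z≤n; s≤s; NonZero; >-nonZero⁻¹)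
open import Data.Nat.Properties hiding (_≟_)
open import Data.Nat.Divisibility using (_∣_; divides; quotient; _∣?_; 1∣_; ∣-trans; *-monoʳ-∣; *-monoˡ-∣)
open import Data.Nat.GCD using (gcd; gcd[m,n]∣m; gcd[m,n]∣n; gcd-greatest)
open import Data.Nat.Primality using (Prime; prime⇒nonZero; prime⇒irreducible; euclidsLemma)
open import Data.Nat.Tactic.RingSolver using (solve-∀)
open import Data.Fin using (Fin; toℕ; fromℕ<) renaming (_<_ to _<ᶠ_)
open import Data.Fin.Properties using (_≟_; any?; pigeonhole; toℕ<n; toℕ-injective; fromℕ<-injective)
  renaming (<-cmp to <ᶠ-cmp; <-trans to <ᶠ-trans; <⇒≢ to <ᶠ⇒≢; ≤∧≢⇒< to ≤∧≢⇒<ᶠ)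
open import Data.Product using (Σ; _,_; _×_; proj₁; proj₂)
open import Data.Sum using (inj₁; inj₂; [_,_]′)
open import Data.Empty using (⊥; ⊥-elim)
open import Function.Definitions using (Injective)
open import Relation.Nullary using (¬_; yes; no; contradiction)
open import Relation.Unary using (Decidable)
open import Relation.Binary.Definitions using (tri<; tri≈; tri>)
open import Relation.Binary.PropositionalEquality

^-monoʳ-∣ : ∀ p {m t} → m ≤ t → p ^ m ∣ p ^ t
^-monoʳ-∣ p {t = t} z≤n       = 1∣ (p ^ t)
^-monoʳ-∣ p         (s≤s m≤t) = *-monoʳ-∣ p (^-monoʳ-∣ p m≤t)

-- A decidable property holding at 0 but not at m has a last point t < m where it
-- still holds; applied to "p^t divides X" it yields the exact valuation of X.
lastBefore : ∀ {P : ℕ → Set} → Decidable P → P 0 → ∀ m → ¬ P m →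
             Σ ℕ λ t → t < m × P t × ¬ P (suc t)
lastBefore P? P0 zero    ¬P0 = contradiction P0 ¬P0
lastBefore P? P0 (suc m) ¬P1+m with P? m
... | yes Pm = m , ≤-refl , Pm , ¬P1+m
... | no ¬Pm with lastBefore P? P0 m ¬Pm
...   | t , t<m , Pt , ¬P1+t = t , m<n⇒m<1+n t<m , Pt , ¬P1+t

unit-part : ∀ p t {X} (pᵗ∣X : p ^ t ∣ X) → ¬ p ^ suc t ∣ X → ¬ p ∣ quotient pᵗ∣X
unit-part p t (divides U refl) pᵗ⁺¹∤X p∣U = pᵗ⁺¹∤X (*-monoˡ-∣ (p ^ t) p∣U)

-- Cancelling a common nonzero factor T·M from a relation between products; this turns
-- Ptolemy's relation for the labels into one for their unit parts.
cancel-scaling : ∀ u₁ w₁ u₂ w₂ u₃ w₃ T M .{{_ : NonZero T}} .{{_ : NonZero M}} →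
                 (u₁ * T) * (w₁ * M) ≡ (u₂ * T) * (w₂ * M) + (u₃ * T) * (w₃ * M) →
                 u₁ * w₁ ≡ u₂ * w₂ + u₃ * w₃
cancel-scaling u₁ w₁ u₂ w₂ u₃ w₃ T M eq =
  *-cancelʳ-≡ _ _ (T * M) {{m*n≢0 T M}} (begin
    u₁ * w₁ * (T * M)                         ≡⟨ regroup u₁ w₁ T M ⟨
    (u₁ * T) * (w₁ * M)                       ≡⟨ eq ⟩
    (u₂ * T) * (w₂ * M) + (u₃ * T) * (w₃ * M) ≡⟨ cong₂ _+_ (regroup u₂ w₂ T M) (regroup u₃ w₃ T M) ⟩
    u₂ * w₂ * (T * M) + u₃ * w₃ * (T * M)     ≡⟨ *-distribʳ-+ (T * M) (u₂ * w₂) (u₃ * w₃) ⟨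
    (u₂ * w₂ + u₃ * w₃) * (T * M)             ∎)
  where
  open ≡-Reasoning
  regroup : ∀ u w T M → (u * T) * (w * M) ≡ u * w * (T * M)
  regroup = solve-∀

argmin : ∀ {q} (f : Fin (suc q) → ℕ) → Σ (Fin (suc q)) λ i → ∀ j → f i ≤ f j
argmin {zero}  f = Fin.zero , λ { Fin.zero → ≤-refl }
argmin {suc q} f with argmin (λ j → f (Fin.suc j))
... | i , min with f Fin.zero ≤? f (Fin.suc i)
...   | yes f0≤ = Fin.zero , λ { Fin.zero → ≤-refl ; (Fin.suc j) → ≤-trans f0≤ (min j) }
...   | no f0≰  = Fin.suc i , λ { Fin.zero → <⇒≤ (≰⇒> f0≰) ; (Fin.suc j) → min j }

-- Residues modulo a prime p.  The residue of U · W⁻¹ mod p ('ratio') is defined through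
-- an inverse of W obtained from Bézout's identity; the main argument uses only its
-- properties ratio<p, ratio≢0 and ratio-distinct.
module ModPrime (p : ℕ) (prime : Prime p) where
  open import Data.Nat.Coprimality using (Coprime; coprime-Bézout)
  open import Data.Nat.GCD using (module Bézout)
  open import Data.Integer using (ℤ; +_; -_; 1ℤ; 0ℤ)
    renaming (_+_ to _+ℤ_; _-_ to _-ℤ_; _*_ to _*ℤ_)
  open import Data.Integer.Properties using (pos-*; neg-distribˡ-*)
  open import Data.Integer.DivMod using (_%ℕ_; _/ℕ_; a≡a%ℕn+[a/ℕn]*n; n%ℕd<d)
  open import Data.Integer.Divisibility.Signed
    using (divides; ∣⇒∣ᵤ; ∣m∣n⇒∣m+n; ∣m∣n⇒∣m-n; ∣n⇒∣m*n) renaming (_∣_ to _∣ℤ_)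
  import Data.Integer.Tactic.RingSolver as ℤ-Ring
  open ≡-Reasoning

  instance
    p≢0 : NonZero p
    p≢0 = prime⇒nonZero prime

  coprime-to : ∀ {W} → ¬ p ∣ W → Coprime p W
  coprime-to p∤W (d∣p , d∣W) with prime⇒irreducible prime d∣p
  ... | inj₁ d≡1 = d≡1
  ... | inj₂ refl = contradiction d∣W p∤W

  lift-Bézout : ∀ a b c d → 1 + a * b ≡ c * d → 1ℤ +ℤ + a *ℤ + b ≡ + c *ℤ + d
  lift-Bézout a b c d eq = begin
    1ℤ +ℤ + a *ℤ + b  ≡⟨ cong (1ℤ +ℤ_) (pos-* a b) ⟨
    + (1 + a * b)     ≡⟨ cong +_ eq ⟩
    + (c * d)         ≡⟨ pos-* c d ⟩
    + c *ℤ + d        ∎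

  inverse : ∀ {W} → ¬ p ∣ W → Σ ℤ λ y → + p ∣ℤ + W *ℤ y -ℤ 1ℤ
  inverse {W} p∤W with coprime-Bézout (coprime-to p∤W)
  ... | Bézout.-+ k y 1+kp≡yW = + y , divides (+ k) (begin
    + W *ℤ + y -ℤ 1ℤ             ≡⟨ cong (_-ℤ 1ℤ) (*-commℤ (+ W) (+ y)) ⟩
    + y *ℤ + W -ℤ 1ℤ             ≡⟨ cong (_-ℤ 1ℤ) (lift-Bézout k p y W 1+kp≡yW) ⟨
    1ℤ +ℤ + k *ℤ + p -ℤ 1ℤ       ≡⟨ add-sub-one (+ k *ℤ + p) ⟩
    + k *ℤ + p                   ∎)
    where
    *-commℤ : ∀ a b → a *ℤ b ≡ b *ℤ a
    *-commℤ = ℤ-Ring.solve-∀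
    add-sub-one : ∀ z → 1ℤ +ℤ z -ℤ 1ℤ ≡ z
    add-sub-one = ℤ-Ring.solve-∀
  ... | Bézout.+- k y 1+yW≡kp = - + y , divides (- + k) (begin
    + W *ℤ - + y -ℤ 1ℤ           ≡⟨ negate (+ W) (+ y) ⟩
    - (1ℤ +ℤ + y *ℤ + W)         ≡⟨ cong -_ (lift-Bézout y W k p 1+yW≡kp) ⟩
    - (+ k *ℤ + p)               ≡⟨ neg-distribˡ-* (+ k) (+ p) ⟩
    - + k *ℤ + p                 ∎)
    where
    negate : ∀ w y → w *ℤ - y -ℤ 1ℤ ≡ - (1ℤ +ℤ y *ℤ w)
    negate = ℤ-Ring.solve-∀

  ratio : (U W : ℕ) → ¬ p ∣ W → ℕ
  ratio U W p∤W = (+ U *ℤ proj₁ (inverse p∤W)) %ℕ p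

  ratio<p : ∀ U W (p∤W : ¬ p ∣ W) → ratio U W p∤W < p
  ratio<p U W p∤W = n%ℕd<d (+ U *ℤ proj₁ (inverse p∤W)) p

  residue-zero : ∀ a → a %ℕ p ≡ 0 → + p ∣ℤ a
  residue-zero a a%p≡0 = divides (a /ℕ p) (begin
    a                                 ≡⟨ a≡a%ℕn+[a/ℕn]*n a p ⟩
    + (a %ℕ p) +ℤ (a /ℕ p) *ℤ + p     ≡⟨ cong (λ r → + r +ℤ (a /ℕ p) *ℤ + p) a%p≡0 ⟩
    0ℤ +ℤ (a /ℕ p) *ℤ + p             ≡⟨ zero-add ((a /ℕ p) *ℤ + p) ⟩
    (a /ℕ p) *ℤ + p                   ∎)
    where
    zero-add : ∀ z → 0ℤ +ℤ z ≡ z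
    zero-add = ℤ-Ring.solve-∀

  same-residue : ∀ a b → a %ℕ p ≡ b %ℕ p → + p ∣ℤ a -ℤ b
  same-residue a b a%p≡b%p = divides (A -ℤ B) (begin
    a -ℤ b
      ≡⟨ cong₂ _-ℤ_ (a≡a%ℕn+[a/ℕn]*n a p) (a≡a%ℕn+[a/ℕn]*n b p) ⟩
    (+ (a %ℕ p) +ℤ A *ℤ + p) -ℤ (+ r +ℤ B *ℤ + p)
      ≡⟨ cong (λ s → (+ s +ℤ A *ℤ + p) -ℤ (+ r +ℤ B *ℤ + p)) a%p≡b%p ⟩
    (+ r +ℤ A *ℤ + p) -ℤ (+ r +ℤ B *ℤ + p)
      ≡⟨ difference (+ r) A B (+ p) ⟩
    (A -ℤ B) *ℤ + p
      ∎)
    where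
    A = a /ℕ p
    B = b /ℕ p
    r = b %ℕ p
    difference : ∀ r A B P → (r +ℤ A *ℤ P) -ℤ (r +ℤ B *ℤ P) ≡ (A -ℤ B) *ℤ P
    difference = ℤ-Ring.solve-∀

  ratio≢0 : ∀ {U W} (p∤W : ¬ p ∣ W) → ¬ p ∣ U → ratio U W p∤W ≢ 0
  ratio≢0 {U} {W} p∤W p∤U ratio≡0 = p∤U (∣⇒∣ᵤ (subst (+ p ∣ℤ_) (cancel (+ U) (+ W) y)
      (∣m∣n⇒∣m-n (∣n⇒∣m*n (+ W) (residue-zero (+ U *ℤ y) ratio≡0)) (∣n⇒∣m*n (+ U) Wy≡1))))
    where
    y = proj₁ (inverse p∤W)
    Wy≡1 = proj₂ (inverse p∤W)
    cancel : ∀ U W y → W *ℤ (U *ℤ y) -ℤ U *ℤ (W *ℤ y -ℤ 1ℤ) ≡ U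
    cancel = ℤ-Ring.solve-∀

  cross-multiply : ∀ {U₁ U₂ W₁ W₂ y₁ y₂} →
                   + p ∣ℤ W₁ *ℤ y₁ -ℤ 1ℤ → + p ∣ℤ W₂ *ℤ y₂ -ℤ 1ℤ →
                   + p ∣ℤ U₁ *ℤ y₁ -ℤ U₂ *ℤ y₂ → + p ∣ℤ U₁ *ℤ W₂ -ℤ U₂ *ℤ W₁
  cross-multiply {U₁} {U₂} {W₁} {W₂} {y₁} {y₂} inv₁ inv₂ same =
    subst (+ p ∣ℤ_) (expand U₁ U₂ W₁ W₂ y₁ y₂)
      (∣m∣n⇒∣m+n (∣m∣n⇒∣m-n (∣n⇒∣m*n (W₁ *ℤ W₂) same) (∣n⇒∣m*n (U₁ *ℤ W₂) inv₁))
                 (∣n⇒∣m*n (U₂ *ℤ W₁) inv₂))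
    where
    expand : ∀ U₁ U₂ W₁ W₂ y₁ y₂ →
             W₁ *ℤ W₂ *ℤ (U₁ *ℤ y₁ -ℤ U₂ *ℤ y₂) -ℤ U₁ *ℤ W₂ *ℤ (W₁ *ℤ y₁ -ℤ 1ℤ)
               +ℤ U₂ *ℤ W₁ *ℤ (W₂ *ℤ y₂ -ℤ 1ℤ) ≡ U₁ *ℤ W₂ -ℤ U₂ *ℤ W₁
    expand = ℤ-Ring.solve-∀

  ratio-distinct : ∀ {u₁ u₂ u₃ w₁ w₂ w₃} (p∤w₁ : ¬ p ∣ w₁) (p∤w₂ : ¬ p ∣ w₂) →
                   u₁ * w₂ ≡ u₂ * w₁ + u₃ * w₃ → ¬ p ∣ u₃ → ¬ p ∣ w₃ →
                   ratio u₁ w₁ p∤w₁ ≢ ratio u₂ w₂ p∤w₂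
  ratio-distinct {u₁} {u₂} {u₃} {w₁} {w₂} {w₃} p∤w₁ p∤w₂ eq p∤u₃ p∤w₃ same =
    [ p∤u₃ , p∤w₃ ]′ (euclidsLemma u₃ w₃ prime (∣⇒∣ᵤ (subst (+ p ∣ℤ_) difference
      (cross-multiply {+ u₁} {+ u₂} {+ w₁} {+ w₂} (proj₂ (inverse p∤w₁)) (proj₂ (inverse p∤w₂))
                      (same-residue (+ u₁ *ℤ y₁) (+ u₂ *ℤ y₂) same)))))
    where
    y₁ = proj₁ (inverse p∤w₁)
    y₂ = proj₁ (inverse p∤w₂)
    cancel-left : ∀ a b → (a +ℤ b) -ℤ a ≡ b
    cancel-left = ℤ-Ring.solve-∀
    difference : + u₁ *ℤ + w₂ -ℤ + u₂ *ℤ + w₁ ≡ + (u₃ * w₃)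
    difference = begin
      + u₁ *ℤ + w₂ -ℤ + u₂ *ℤ + w₁       ≡⟨ cong₂ _-ℤ_ (pos-* u₁ w₂) (pos-* u₂ w₁) ⟨
      + (u₁ * w₂) -ℤ + (u₂ * w₁)         ≡⟨ cong (λ z → + z -ℤ + (u₂ * w₁)) eq ⟩
      + (u₂ * w₁ + u₃ * w₃) -ℤ + (u₂ * w₁) ≡⟨ cancel-left (+ (u₂ * w₁)) (+ (u₃ * w₃)) ⟩
      + (u₃ * w₃)                        ∎

module Frieze {n : ℕ} {c : Fin n → Fin n → ℕ} (F : IsPositiveFrieze n c) where
  open IsPositiveFrieze F

  ∣-sym : ∀ {q i j} → i ≢ j → q ∣ c i j → q ∣ c j i
  ∣-sym {q} {i} {j} i≢j = subst (q ∣_) (symmetric i j i≢j)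

  -- In a triangle i < j < k the gcd condition makes the gcds of all pairs of sides
  -- equal, so a common divisor of two sides divides the third.
  module _ (G : TrianglesGcdCondition n c) {q : ℕ} {i j k : Fin n}
           (i<j : i <ᶠ j) (j<k : j <ᶠ k) where
    gcd-ij-jk≡gcd-ij-ik : gcd (c i j) (c j k) ≡ gcd (c i j) (c i k)
    gcd-ij-jk≡gcd-ij-ik = trans (proj₁ (G i j k i<j j<k)) (proj₂ (G i j k i<j j<k))

    third-ik : q ∣ c i j → q ∣ c j k → q ∣ c i k
    third-ik q∣ij q∣jk = ∣-trans (gcd-greatest q∣ij q∣jk)
      (subst (_∣ c i k) (sym gcd-ij-jk≡gcd-ij-ik) (gcd[m,n]∣n (c i j) (c i k)))

    third-ij : q ∣ c j k → q ∣ c i k → q ∣ c i j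
    third-ij q∣jk q∣ik = ∣-trans (gcd-greatest q∣jk q∣ik)
      (subst (_∣ c i j) (proj₁ (G i j k i<j j<k)) (gcd[m,n]∣m (c i j) (c j k)))

    third-jk : q ∣ c i j → q ∣ c i k → q ∣ c j k
    third-jk q∣ij q∣ik = ∣-trans (gcd-greatest q∣ij q∣ik)
      (subst (_∣ c j k) (proj₂ (G i j k i<j j<k)) (gcd[m,n]∣m (c j k) (c i k)))

  path< : TrianglesGcdCondition n c → ∀ {q i j k} → i <ᶠ k → i ≢ j → j ≢ k →
          q ∣ c i j → q ∣ c j k → q ∣ c i k
  path< G {i = i} {j} {k} i<k i≢j j≢k q∣ij q∣jk with <ᶠ-cmp i j | <ᶠ-cmp j k
  ... | tri< i<j _ _ | tri< j<k _ _ = third-ik G i<j j<k q∣ij q∣jk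
  ... | tri≈ _ i≡j _ | _            = contradiction i≡j i≢j
  ... | _            | tri≈ _ j≡k _ = contradiction j≡k j≢k
  ... | tri> _ _ j<i | _            = third-jk G j<i i<k (∣-sym i≢j q∣ij) q∣jk
  ... | tri< _ _ _   | tri> _ _ k<j = third-ij G i<k k<j (∣-sym j≢k q∣jk) q∣ij

  triangle : TrianglesGcdCondition n c → ∀ {q i j k} → i ≢ j → j ≢ k → i ≢ k →
             q ∣ c i j → q ∣ c j k → q ∣ c i k
  triangle G {i = i} {j} {k} i≢j j≢k i≢k q∣ij q∣jk with <ᶠ-cmp i k
  ... | tri< i<k _ _ = path< G i<k i≢j j≢k q∣ij q∣jk
  ... | tri≈ _ i≡k _ = contradiction i≡k i≢k
  ... | tri> _ _ k<i = ∣-sym (≢-sym i≢k)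
        (path< G k<i (≢-sym j≢k) (≢-sym i≢j) (∣-sym j≢k q∣jk) (∣-sym i≢j q∣ij))

  PtolemyAt : Fin n → Fin n → Fin n → Fin n → Set
  PtolemyAt i j k l = c i k * c j l ≡ c i l * c j k + c i j * c k l

  -- By symmetry of the labels the relation is invariant under rotating the vertices.
  rotate : ∀ {i j k l} → i ≢ j → i ≢ k → i ≢ l → PtolemyAt i j k l → PtolemyAt j k l i
  rotate {i} {j} {k} {l} i≢j i≢k i≢l ptolemy-ijkl = begin
    c j l * c k i                  ≡⟨ cong (c j l *_) (symmetric k i (≢-sym i≢k)) ⟩
    c j l * c i k                  ≡⟨ *-comm (c j l) (c i k) ⟩
    c i k * c j l                  ≡⟨ ptolemy-ijkl ⟩
    c i l * c j k + c i j * c k l  ≡⟨ +-comm (c i l * c j k) (c i j * c k l) ⟩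
    c i j * c k l + c i l * c j k  ≡⟨ cong₂ _+_ (cong (_* c k l) (symmetric i j i≢j)) il·jk≡jk·li ⟩
    c j i * c k l + c j k * c l i  ∎
    where
    open ≡-Reasoning
    il·jk≡jk·li : c i l * c j k ≡ c j k * c l i
    il·jk≡jk·li = trans (*-comm (c i l) (c j k)) (cong (c j k *_) (symmetric i l i≢l))

  ptolemy-rotations : ∀ {i j k l} → i <ᶠ j → j <ᶠ k → k <ᶠ l →
                      PtolemyAt j k l i × PtolemyAt k l i j × PtolemyAt l i j k
  ptolemy-rotations {i} {j} {k} {l} i<j j<k k<l = P₁ , P₂ , P₃
    where
    i<k = <ᶠ-trans i<j j<k
    j<l = <ᶠ-trans j<k k<l
    i<l = <ᶠ-trans i<k k<l
    P₁ = rotate (<ᶠ⇒≢ i<j) (<ᶠ⇒≢ i<k) (<ᶠ⇒≢ i<l) (ptolemy i j k l i<j j<k k<l)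
    P₂ = rotate (<ᶠ⇒≢ j<k) (<ᶠ⇒≢ j<l) (≢-sym (<ᶠ⇒≢ i<j)) P₁
    P₃ = rotate (<ᶠ⇒≢ k<l) (≢-sym (<ᶠ⇒≢ i<k)) (≢-sym (<ᶠ⇒≢ j<k)) P₂

  -- Position of y in the cyclic order of the vertices that starts at x.
  rank : Fin n → Fin n → ℕ
  rank x y with toℕ x ≤? toℕ y
  ... | yes _ = toℕ y
  ... | no _  = n + toℕ y

  -- Ranks below x never collide with ranks from x on.
  below-wrapped : ∀ (a b : Fin n) → toℕ a < n + toℕ b
  below-wrapped a b = <-≤-trans (toℕ<n a) (m≤m+n n (toℕ b))

  rank-injective : ∀ x {a b} → rank x a ≡ rank x b → a ≡ b
  rank-injective x {a} {b} same with toℕ x ≤? toℕ a | toℕ x ≤? toℕ b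
  ... | yes _ | yes _ = toℕ-injective same
  ... | no _  | no _  = toℕ-injective (+-cancelˡ-≡ n _ _ same)
  ... | yes _ | no _  = contradiction same (<⇒≢ (below-wrapped a b))
  ... | no _  | yes _ = contradiction (sym same) (<⇒≢ (below-wrapped b a))

  -- Vertices a, b, e following x in this cyclic order satisfy Ptolemy's relation
  -- for the quadrilateral x, a, b, e: according to how many of a, b, e precede x in
  -- the numbering, x, a, b, e is a rotation of an increasing quadruple.
  rank-ptolemy : ∀ {x a b e} → x ≢ a → x ≢ e →
                 rank x a < rank x b → rank x b < rank x e → PtolemyAt x a b e
  rank-ptolemy {x} {a} {b} {e} x≢a x≢e a<b b<e
    with toℕ x ≤? toℕ a | toℕ x ≤? toℕ b | toℕ x ≤? toℕ e
  ... | yes x≤a | yes _  | yes _   = ptolemy x a b e (≤∧≢⇒<ᶠ x≤a x≢a) a<b b<e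
  ... | yes x≤a | yes _  | no x≰e  = proj₁ (ptolemy-rotations (≰⇒> x≰e) (≤∧≢⇒<ᶠ x≤a x≢a) a<b)
  ... | yes x≤a | no _   | no x≰e  =
        proj₁ (proj₂ (ptolemy-rotations (+-cancelˡ-< n _ _ b<e) (≰⇒> x≰e) (≤∧≢⇒<ᶠ x≤a x≢a)))
  ... | no _    | no _   | no x≰e  =
        proj₂ (proj₂ (ptolemy-rotations (+-cancelˡ-< n _ _ a<b) (+-cancelˡ-< n _ _ b<e) (≰⇒> x≰e)))
  ... | yes _   | no _   | yes _   = contradiction (below-wrapped e b) (<⇒≯ b<e)
  ... | no _    | yes _  | _       = contradiction (below-wrapped b a) (<⇒≯ a<b)
  ... | no _    | no _   | yes _   = contradiction (below-wrapped e b) (<⇒≯ b<e)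

module Proposition {n : ℕ} {c : Fin n → Fin n → ℕ} (F : IsPositiveFrieze n c)
                   (G : TrianglesGcdCondition n c) {p m : ℕ} (prime : Prime p)
                   {v : Fin (suc p) → Fin n} (v-injective : Injective _≡_ _≡_ v)
                   (D-valuation : ∀ a b → a ≢ b → HasValuation p m (c (v a) (v b))) where
  open Frieze F
  open ModPrime p prime

  v-≢ : ∀ {a b} → a ≢ b → v a ≢ v b
  v-≢ a≢b va≡vb = a≢b (v-injective va≡vb)

  -- If x ∉ D and one edge from x to D has valuation t < m, then, by the triangle
  -- lemma with the D-edges (divisible by p^m), all edges from x to D have valuation t.
  uniform-valuation : ∀ {x t} k₀ → (∀ k → x ≢ v k) → t < m →
                      HasValuation p t (c x (v k₀)) → ∀ k → HasValuation p t (c x (v k))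
  uniform-valuation {x} {t} k₀ x∉D t<m (pᵗ∣ , pᵗ⁺¹∤) k with k ≟ k₀
  ... | yes refl = pᵗ∣ , pᵗ⁺¹∤
  ... | no k≢k₀  =
        triangle G (x∉D k₀) (v-≢ (≢-sym k≢k₀)) (x∉D k) pᵗ∣
          (∣-trans (^-monoʳ-∣ p (<⇒≤ t<m)) (proj₁ (D-valuation k₀ k (≢-sym k≢k₀))))
      , λ pᵗ⁺¹∣ → pᵗ⁺¹∤ (triangle G (x∉D k) (v-≢ k≢k₀) (x∉D k₀) pᵗ⁺¹∣
          (∣-trans (^-monoʳ-∣ p t<m) (proj₁ (D-valuation k k₀ k≢k₀))))

  -- No vertex x ∉ D has all its edges to D of one common valuation t: this is the
  -- pigeonhole argument of the proof.
  module Outside {x : Fin n} (x∉D : ∀ k → x ≢ v k) {t : ℕ}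
                 (valuation : ∀ k → HasValuation p t (c x (v k))) where
    -- Unit parts: c(x, v k) = U k · p^t and c(v a, v b) = W a b · p^m.
    U : Fin (suc p) → ℕ
    U k = quotient (proj₁ (valuation k))

    U-unit : ∀ k → ¬ p ∣ U k
    U-unit k = unit-part p t (proj₁ (valuation k)) (proj₂ (valuation k))

    W : ∀ a b → a ≢ b → ℕ
    W a b a≢b = quotient (proj₁ (D-valuation a b a≢b))

    W-unit : ∀ {a b} (a≢b : a ≢ b) → ¬ p ∣ W a b a≢b
    W-unit {a} {b} a≢b = unit-part p m (proj₁ (D-valuation a b a≢b)) (proj₂ (D-valuation a b a≢b))

    -- The first vertex of D after x in cyclic order.
    a₀ : Fin (suc p)
    a₀ = proj₁ (argmin (λ k → rank x (v k)))

    a₀-first : ∀ {b} → b ≢ a₀ → rank x (v a₀) < rank x (v b)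
    a₀-first {b} b≢a₀ = ≤∧≢⇒< (proj₂ (argmin (λ k → rank x (v k))) b)
                               (λ same → b≢a₀ (sym (v-injective (rank-injective x same))))

    -- Ptolemy's relation for x, v a₀, v b, v e divided by p^(t+m).
    reduced-ptolemy : ∀ {b e} (b≢a₀ : b ≢ a₀) (e≢a₀ : e ≢ a₀) (b≢e : b ≢ e) →
                      rank x (v b) < rank x (v e) →
                      U b * W a₀ e (≢-sym e≢a₀) ≡ U e * W a₀ b (≢-sym b≢a₀) + U a₀ * W b e b≢e
    reduced-ptolemy {b} {e} b≢a₀ e≢a₀ b≢e b<e =
      cancel-scaling (U b) (W a₀ e _) (U e) (W a₀ b _) (U a₀) (W b e b≢e) (p ^ t) (p ^ m) (begin
      (U b * p ^ t) * (W a₀ e _ * p ^ m)  ≡⟨ cong₂ _*_ (unit b) (pair (≢-sym e≢a₀)) ⟨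
      c x (v b) * c (v a₀) (v e)          ≡⟨ rank-ptolemy (x∉D a₀) (x∉D e) (a₀-first b≢a₀) b<e ⟩
      c x (v e) * c (v a₀) (v b) + c x (v a₀) * c (v b) (v e)
                                          ≡⟨ cong₂ _+_ (cong₂ _*_ (unit e) (pair (≢-sym b≢a₀)))
                                                       (cong₂ _*_ (unit a₀) (pair b≢e)) ⟩
      (U e * p ^ t) * (W a₀ b _ * p ^ m) + (U a₀ * p ^ t) * (W b e b≢e * p ^ m) ∎)
      where
      open ≡-Reasoning
      instance
        pᵗ≢0 : NonZero (p ^ t)
        pᵗ≢0 = m^n≢0 p t
        pᵐ≢0 : NonZero (p ^ m)
        pᵐ≢0 = m^n≢0 p m
      unit : ∀ k → c x (v k) ≡ U k * p ^ t
      unit k = _∣_.equality (proj₁ (valuation k))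
      pair : ∀ {a b} (a≢b : a ≢ b) → c (v a) (v b) ≡ W a b a≢b * p ^ m
      pair {a} {b} a≢b = _∣_.equality (proj₁ (D-valuation a b a≢b))

    residue : ∀ b → b ≢ a₀ → ℕ
    residue b b≢a₀ = ratio (U b) (W a₀ b (≢-sym b≢a₀)) (W-unit (≢-sym b≢a₀))

    -- These residues are nonzero because U b is a unit, and pairwise distinct by the
    -- reduced Ptolemy relation.
    residue≢0 : ∀ {b} (b≢a₀ : b ≢ a₀) → residue b b≢a₀ ≢ 0
    residue≢0 {b} b≢a₀ = ratio≢0 (W-unit (≢-sym b≢a₀)) (U-unit b)

    residue-distinct : ∀ {b e} (b≢a₀ : b ≢ a₀) (e≢a₀ : e ≢ a₀) → rank x (v b) < rank x (v e) →
                       residue b b≢a₀ ≢ residue e e≢a₀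
    residue-distinct {b} {e} b≢a₀ e≢a₀ b<e =
      ratio-distinct {U b} {U e} (W-unit (≢-sym b≢a₀)) (W-unit (≢-sym e≢a₀))
        (reduced-ptolemy b≢a₀ e≢a₀ b≢e b<e) (U-unit a₀) (W-unit b≢e)
      where
      b≢e : b ≢ e
      b≢e b≡e = <-irrefl (cong (λ k → rank x (v k)) b≡e) b<e

    code : Fin (suc p) → ℕ
    code b with b ≟ a₀
    ... | yes _    = 0
    ... | no b≢a₀ = residue b b≢a₀

    code<p : ∀ b → code b < p
    code<p b with b ≟ a₀
    ... | yes _    = >-nonZero⁻¹ p
    ... | no b≢a₀ = ratio<p (U b) (W a₀ b (≢-sym b≢a₀)) (W-unit (≢-sym b≢a₀))

    code-injective : ∀ {b e} → code b ≡ code e → b ≡ e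
    code-injective {b} {e} same with b ≟ a₀ | e ≟ a₀
    ... | yes b≡a₀ | yes e≡a₀ = trans b≡a₀ (sym e≡a₀)
    ... | yes _    | no e≢a₀  = contradiction (sym same) (residue≢0 e≢a₀)
    ... | no b≢a₀  | yes _    = contradiction same (residue≢0 b≢a₀)
    ... | no b≢a₀  | no e≢a₀  with <-cmp (rank x (v b)) (rank x (v e))
    ...   | tri< b<e _ _ = contradiction same (residue-distinct b≢a₀ e≢a₀ b<e)
    ...   | tri≈ _ b≈e _ = v-injective (rank-injective x b≈e)
    ...   | tri> _ _ e<b = contradiction (sym same) (residue-distinct e≢a₀ b≢a₀ e<b)

    -- An injective map from the p+1 vertices of D into p residues is impossible.
    impossible : ⊥
    impossible with pigeonhole (n<1+n p) (λ b → fromℕ< (code<p b))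
    ... | b , e , b<e , same =
          <ᶠ⇒≢ b<e (code-injective (fromℕ<-injective (code b) (code e) (code<p b) (code<p e) same))

  toD-divisible : ∀ x k → x ≢ v k → p ^ m ∣ c x (v k)
  toD-divisible x k x≢vk with any? (λ l → v l ≟ x)
  ... | yes (l , refl) = proj₁ (D-valuation l k (λ l≡k → x≢vk (cong v l≡k)))
  ... | no x∈D⇒⊥ with p ^ m ∣? c x (v k)
  ...   | yes pᵐ∣ = pᵐ∣
  ...   | no pᵐ∤ with lastBefore (λ t → p ^ t ∣? c x (v k)) (1∣ c x (v k)) m pᵐ∤
  ...     | t , t<m , pᵗ∣ , pᵗ⁺¹∤ =
            ⊥-elim (Outside.impossible x∉D {t} (uniform-valuation k x∉D t<m (pᵗ∣ , pᵗ⁺¹∤)))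
    where
    x∉D : ∀ l → x ≢ v l
    x∉D l x≡vl = x∈D⇒⊥ (l , sym x≡vl)

  every-edge : ∀ i j → i ≢ j → p ^ m ∣ c i j
  every-edge i j i≢j with any? (λ l → v l ≟ i) | any? (λ l → v l ≟ j)
  ... | yes (l , refl) | _ = ∣-sym (≢-sym i≢j) (toD-divisible j l (≢-sym i≢j))
  ... | no _ | yes (l , refl) = toD-divisible i l i≢j
  ... | no i∉D | no j∉D = triangle G i≢v₀ (≢-sym j≢v₀) i≢j
          (toD-divisible i Fin.zero i≢v₀) (∣-sym j≢v₀ (toD-divisible j Fin.zero j≢v₀))
    where
    i≢v₀ : i ≢ v Fin.zero
    i≢v₀ i≡v₀ = i∉D (Fin.zero , sym i≡v₀)
    j≢v₀ : j ≢ v Fin.zero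
    j≢v₀ j≡v₀ = j∉D (Fin.zero , sym j≡v₀)

proposition4p2 : (n : ℕ) (c : Fin n → Fin n → ℕ) → IsPositiveFrieze n c →
    TrianglesGcdCondition n c →
    (p m : ℕ) → Prime p →
    Σ (Fin (suc p) → Fin n) (SubpolygonWithValuation n c (suc p) p m) →
    ∀ i j → i ≢ j → p ^ m ∣ c i j
proposition4p2 n c F G p m prime (v , v-injective , D-valuation) =
  Proposition.every-edge F G {p} {m} prime v-injective D-valuation
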